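{- The canonical join complex of the weak order on permutations of $\{1,\ldots,n\}$ is flag.
   Context: Weak order: $x\le y$ iff $\operatorname{inv}(x)\subseteq\operatorname{inv}(y)$, where $\operatorname{inv}(x)$ is the set of pairs $(x_i,x_j)$ with $i<j$ and $x_i>x_j$; it is a lattice in which every element has a canonical join representation. In a finite lattice, $x=\bigvee S$ is the canonical join representation of $x$ if it is irredundant and for every $T$ with $\bigvee T=x$ each $s\in S$ lies below some element of $T$. The canonical join complex is the simplicial complex whose vertices are the join-irreducible elements and whose faces are the sets $S$ such that $\bigvee S$ is a canonical join representation. A simplicial complex is flag if it is the clique complex of its $1$-skeleton, i.e. every set of vertices that pairwise form edges is a face. -}

module Defs where

open import Data.Nat using (ℕ)
open import Data.Fin using (Fin; _<_)
open import Data.Fin.Permutation using (Permutation′; _⟨$⟩ʳ_; _⟨$⟩ˡ_)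
open import Data.List using (List; []; _∷_)
open import Data.List.Relation.Unary.All using (All)
open import Data.List.Relation.Unary.Any using (Any)
open import Data.Product using (Σ; _×_; ∃)
open import Data.Sum using (_⊎_)
open import Relation.Binary.PropositionalEquality using (_≡_)
open import Relation.Nullary using (¬_)

-- Permutations of {1,…,n} (encoded as Fin n); one-line notation x_i = x ⟨$⟩ʳ i,
-- and x ⟨$⟩ˡ a is the position at which the value a occurs.
Perm : ℕ → Set
Perm n = Permutation′ n

_≈_ : ∀ {n} → Perm n → Perm n → Set
x ≈ y = ∀ i → x ⟨$⟩ʳ i ≡ y ⟨$⟩ʳ i

-- (a , b) ∈ inv(x): the larger value a occurs before the smaller value b,
-- i.e. a = x_i, b = x_j with i < j and x_i > x_j.
Inv : ∀ {n} → Perm n → Fin n → Fin n → Set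
Inv x a b = (b < a) × (x ⟨$⟩ˡ a < x ⟨$⟩ˡ b)

_≤w_ : ∀ {n} → Perm n → Perm n → Set
x ≤w y = ∀ a b → Inv x a b → Inv y a b

_∈≈_ : ∀ {n} → Perm n → List (Perm n) → Set
x ∈≈ S = Any (x ≈_) S

_⊆≈_ : ∀ {n} → List (Perm n) → List (Perm n) → Set
T ⊆≈ S = All (_∈≈ S) T

IsJoin : ∀ {n} → List (Perm n) → Perm n → Set
IsJoin {n} S x = All (_≤w x) S × (∀ (u : Perm n) → All (_≤w u) S → x ≤w u)

JoinIrreducible : ∀ {n} → Perm n → Set
JoinIrreducible {n} j =
  ¬ IsJoin [] j ×
  (∀ (a b : Perm n) → IsJoin (a ∷ b ∷ []) j → (j ≈ a) ⊎ (j ≈ b))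

Irredundant : ∀ {n} → List (Perm n) → Perm n → Set
Irredundant {n} S x =
  ∀ (T : List (Perm n)) → T ⊆≈ S → (Σ (Perm n) λ s → s ∈≈ S × ¬ (s ∈≈ T)) →
  ¬ IsJoin T x

CanonicalJoinRep : ∀ {n} → List (Perm n) → Perm n → Set
CanonicalJoinRep {n} S x =
  IsJoin S x × Irredundant S x ×
  (∀ (T : List (Perm n)) → IsJoin T x →
     All (λ s → Any (λ t → s ≤w t) T) S)

Face : ∀ {n} → List (Perm n) → Set
Face {n} S = All JoinIrreducible S × ∃ λ (x : Perm n) → CanonicalJoinRep S x

Edge : ∀ {n} → Perm n → Perm n → Set
Edge a b = Face (a ∷ b ∷ [])

CanonicalJoinComplexIsFlag : ℕ → Set
CanonicalJoinComplexIsFlag n =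
  ∀ (S : List (Perm n)) → All JoinIrreducible S →
  (∀ a b → a ∈≈ S → b ∈≈ S → ¬ (a ≈ b) → Edge a b) →
  Face S

-- A descent (c, d) of x is a pair of values with d < c and d placed right after c. Joins exist
-- (descend from the longest permutation, swapping descents inverted by no element of S), and x = ⋁T
-- exactly when x bounds T and each descent of x is inverted by some element of T.
--
-- If {s, t} is an edge with join y, some descent (p, q) of y is not inverted by t, hence is inverted
-- by s, and canonicity forces s to be the least permutation below y inverting (p, q); all inversions
-- of s are then generated by (p, q), which determines (p, q). For pairwise edges S, each s ∈ S thus
-- comes with one (p, q) that no other element of S inverts, and (p, q) is still a descent of ⋁S:
-- inversions of ⋁S never lower a rank separating p from the values strictly between q and p, and the
-- element of S inverting the descent where ⋁S crosses from above q to below must be s itself. So any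
-- T with ⋁T = ⋁S has an element inverting (p, q), which lies above s, and if T ⊆ S that element is s.

module Submission where

open import Defs
open import Data.Nat as ℕ using (ℕ; zero; suc; z≤n; s≤s)
import Data.Nat.Properties as ℕP
open import Data.Fin as F using (Fin; toℕ; fromℕ<; _<_)
import Data.Fin.Properties as FP
open import Data.Fin.Permutation using (_⟨$⟩ʳ_; _⟨$⟩ˡ_; inverseˡ; inverseʳ; transpose; reverse; id; _∘ₚ_)
import Data.Fin.Permutation.Components as PC
open import Data.List using (List; []; _∷_)
open import Data.List.Relation.Unary.All as All using (All; []; _∷_)
open import Data.List.Relation.Unary.All.Properties using (¬Any⇒All¬)
open import Data.List.Relation.Unary.Any as Any using (Any; here; there)
open import Data.Product using (Σ; _×_; ∃; ∃₂; _,_; proj₁; proj₂)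
open import Data.Sum using (_⊎_; inj₁; inj₂; [_,_]′; map₁; map₂)
open import Data.Empty using (⊥; ⊥-elim)
open import Relation.Binary using (tri<; tri≈; tri>)
open import Relation.Binary.PropositionalEquality
  using (_≡_; _≢_; refl; sym; trans; cong; subst; subst₂; module ≡-Reasoning)
open import Relation.Nullary using (¬_; Dec; yes; no; ¬?)
open import Relation.Nullary.Decidable using (_×-dec_; decidable-stable; map′)

∑ : ∀ {m} → (Fin m → ℕ) → ℕ
∑ {zero}  f = 0
∑ {suc m} f = f F.zero ℕ.+ ∑ (λ i → f (F.suc i))

∑-mono : ∀ {m} {f g : Fin m → ℕ} → (∀ i → f i ℕ.≤ g i) → ∑ f ℕ.≤ ∑ g
∑-mono {zero}  f≤g = z≤n
∑-mono {suc m} f≤g = ℕP.+-mono-≤ (f≤g F.zero) (∑-mono (λ i → f≤g (F.suc i)))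

∑-mono-< : ∀ {m} {f g : Fin m → ℕ} → (∀ i → f i ℕ.≤ g i) → ∀ k → f k ℕ.< g k → ∑ f ℕ.< ∑ g
∑-mono-< {suc m} f≤g F.zero    fk<gk = ℕP.+-mono-<-≤ fk<gk (∑-mono (λ i → f≤g (F.suc i)))
∑-mono-< {suc m} f≤g (F.suc k) fk<gk = ℕP.+-mono-≤-< (f≤g F.zero) (∑-mono-< (λ i → f≤g (F.suc i)) k fk<gk)

[_] : ∀ {A : Set} → Dec A → ℕ
[ yes _ ] = 1
[ no  _ ] = 0

[]-mono : ∀ {A B : Set} → (A → B) → (a? : Dec A) (b? : Dec B) → [ a? ] ℕ.≤ [ b? ]
[]-mono A⇒B (yes a) (yes _) = ℕP.≤-refl
[]-mono A⇒B (yes a) (no ¬b) = ⊥-elim (¬b (A⇒B a))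
[]-mono A⇒B (no _)  _       = z≤n

[]-mono-< : ∀ {A B : Set} → ¬ A → B → (a? : Dec A) (b? : Dec B) → [ a? ] ℕ.< [ b? ]
[]-mono-< ¬a b (yes a) _       = ⊥-elim (¬a a)
[]-mono-< ¬a b (no _)  (yes _) = ℕP.n<1+n 0
[]-mono-< ¬a b (no _)  (no ¬b) = ⊥-elim (¬b b)

module _ {n : ℕ} where

  -- Positions and inversions

  pos : Perm n → Fin n → ℕ
  pos x a = toℕ (x ⟨$⟩ˡ a)

  pos-injective : (x : Perm n) {a b : Fin n} → pos x a ≡ pos x b → a ≡ b
  pos-injective x {a} {b} e =
    trans (sym (inverseʳ x)) (trans (cong (x ⟨$⟩ʳ_) (FP.toℕ-injective e)) (inverseʳ x))

  ≯⇒≡⊎< : {i j : Fin n} → ¬ (j < i) → i ≡ j ⊎ i < j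
  ≯⇒≡⊎< {i} {j} j≮i with FP.<-cmp i j
  ... | tri< i<j _ _ = inj₂ i<j
  ... | tri≈ _ i≡j _ = inj₁ i≡j
  ... | tri> _ _ j<i = ⊥-elim (j≮i j<i)

  ≈-sym : {x y : Perm n} → x ≈ y → y ≈ x
  ≈-sym x≈y i = sym (x≈y i)

  ≈-trans : {x y z : Perm n} → x ≈ y → y ≈ z → x ≈ z
  ≈-trans x≈y y≈z i = trans (x≈y i) (y≈z i)

  _≈?_ : (x y : Perm n) → Dec (x ≈ y)
  x ≈? y = FP.all? (λ i → (x ⟨$⟩ʳ i) FP.≟ (y ⟨$⟩ʳ i))

  ≈⇒pos≡ : {x y : Perm n} → x ≈ y → ∀ a → pos x a ≡ pos y a
  ≈⇒pos≡ {x} {y} x≈y a = cong toℕ (begin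
      x ⟨$⟩ˡ a                        ≡⟨ inverseˡ y ⟨
      y ⟨$⟩ˡ (y ⟨$⟩ʳ (x ⟨$⟩ˡ a))      ≡⟨ cong (y ⟨$⟩ˡ_) (x≈y (x ⟨$⟩ˡ a)) ⟨
      y ⟨$⟩ˡ (x ⟨$⟩ʳ (x ⟨$⟩ˡ a))      ≡⟨ cong (y ⟨$⟩ˡ_) (inverseʳ x) ⟩
      y ⟨$⟩ˡ a                        ∎)
    where open ≡-Reasoning

  ≈⇒≤w : {x y : Perm n} → x ≈ y → x ≤w y
  ≈⇒≤w {x} {y} x≈y a b (b<a , a<b) = b<a , subst₂ ℕ._<_ (≈⇒pos≡ {x} {y} x≈y a) (≈⇒pos≡ {x} {y} x≈y b) a<b

  ≤w-refl : {x : Perm n} → x ≤w x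
  ≤w-refl _ _ i = i

  ≤w-trans : {x y z : Perm n} → x ≤w y → y ≤w z → x ≤w z
  ≤w-trans x≤y y≤z a b i = y≤z a b (x≤y a b i)

  Any⇒∈≈ : {P : Perm n → Set} {T : List (Perm n)} → Any P T → ∃ λ t → t ∈≈ T × P t
  Any⇒∈≈ (here pt)  = _ , here (λ _ → refl) , pt
  Any⇒∈≈ (there ps) with Any⇒∈≈ ps
  ... | t , t∈T , pt = t , there t∈T , pt

  All-∈≈ : {P : Perm n → Set} {T : List (Perm n)} → (∀ {u v} → u ≈ v → P v → P u) →
           All P T → ∀ {t} → t ∈≈ T → P t
  All-∈≈ resp all t∈T with All.lookupAny all t∈T
  ... | pv , t≈v = resp t≈v pv

  ∈≈-resp : {T : List (Perm n)} → ∀ {u v} → u ≈ v → v ∈≈ T → u ∈≈ T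
  ∈≈-resp {u = u} {v} u≈v = Any.map λ {w} v≈w → ≈-trans {x = u} {v} {w} u≈v v≈w

  ∈≈-⊆ : {T S : List (Perm n)} → T ⊆≈ S → ∀ {t} → t ∈≈ T → t ∈≈ S
  ∈≈-⊆ = All-∈≈ λ {u} {v} → ∈≈-resp {u = u} {v}

  ∈≈-upper : {T : List (Perm n)} {x : Perm n} → All (_≤w x) T → ∀ {t} → t ∈≈ T → t ≤w x
  ∈≈-upper {x = x} = All-∈≈ λ {u} {v} u≈v v≤x → ≤w-trans {x = u} {v} {x} (≈⇒≤w {x = u} {v} u≈v) v≤x

  ∈≈-constant : {T : List (Perm n)} {s₀ : Perm n} → All (_≈ s₀) T → ∀ {t} → t ∈≈ T → t ≈ s₀
  ∈≈-constant {s₀ = s₀} = All-∈≈ λ {u} {v} → ≈-trans {x = u} {v} {s₀}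

  id-least : (x : Perm n) → id ≤w x
  id-least x a b (b<a , a<b) = ⊥-elim (ℕP.<-asym b<a a<b)

  reverse-greatest : (x : Perm n) → x ≤w reverse
  reverse-greatest x a b (b<a , _) =
    b<a , subst₂ ℕ._<_ (sym (FP.opposite-prop a)) (sym (FP.opposite-prop b))
                       (ℕP.∸-monoʳ-< (s≤s b<a) (FP.toℕ<n a))

  Inv? : (x : Perm n) → ∀ a b → Dec (Inv x a b)
  Inv? x a b = (b F.<? a) ×-dec (x ⟨$⟩ˡ a F.<? x ⟨$⟩ˡ b)

  Inv-trans : (x : Perm n) {a b c : Fin n} → Inv x a b → Inv x b c → Inv x a c
  Inv-trans x (b<a , ab) (c<b , bc) = ℕP.<-trans c<b b<a , ℕP.<-trans ab bc

  Inv-split : (x : Perm n) {a b c : Fin n} → Inv x a c → c < b → b < a → Inv x a b ⊎ Inv x b c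
  Inv-split x {a} {b} {c} (_ , ac) c<b b<a with ℕP.<-cmp (pos x a) (pos x b)
  ... | tri< ab _ _ = inj₁ (b<a , ab)
  ... | tri≈ _ ab _ = ⊥-elim (FP.<-irrefl (sym (pos-injective x ab)) b<a)
  ... | tri> _ _ ba = inj₂ (c<b , ℕP.<-trans ba ac)

  pos≤⇒¬Inv : (x : Perm n) {a b : Fin n} → pos x a ℕ.≤ pos x b → ¬ Inv x b a
  pos≤⇒¬Inv x ab (_ , ba) = ℕP.<-irrefl refl (ℕP.<-≤-trans ba ab)

  Adjacent : Perm n → Fin n → Fin n → Set
  Adjacent x c d = suc (pos x c) ≡ pos x d

  record Descent (x : Perm n) (c d : Fin n) : Set where
    constructor descent
    field
      smaller  : d < c
      adjacent : Adjacent x c d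

  Descent? : (x : Perm n) → ∀ c d → Dec (Descent x c d)
  Descent? x c d = map′ (λ (d<c , adj) → descent d<c adj) (λ (descent d<c adj) → d<c , adj)
                        ((d F.<? c) ×-dec (suc (pos x c) ℕP.≟ pos x d))

  Descent⇒Inv : {x : Perm n} {c d : Fin n} → Descent x c d → Inv x c d
  Descent⇒Inv (descent d<c adj) = d<c , ℕP.≤-reflexive adj

  nothing-between : (x : Perm n) {p q m : Fin n} → Adjacent x p q →
                    pos x p ℕ.< pos x m → pos x m ℕ.< pos x q → ⊥
  nothing-between x adj pm mq = ℕP.<-irrefl refl (ℕP.<-≤-trans mq (subst (ℕ._≤ _) adj pm))

  -- Swapping the two values of a descent

  transpose-at-i : (i j : Fin n) → PC.transpose i j i ≡ j
  transpose-at-i i j with i FP.≟ i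
  ... | yes _   = refl
  ... | no  i≢i = ⊥-elim (i≢i refl)

  transpose-at-j : (i j : Fin n) → PC.transpose i j j ≡ i
  transpose-at-j i j with j FP.≟ i
  ... | yes j≡i = j≡i
  ... | no  _ with j FP.≟ j
  ...   | yes _   = refl
  ...   | no  j≢j = ⊥-elim (j≢j refl)

  transpose-elsewhere : {i j k : Fin n} → k ≢ i → k ≢ j → PC.transpose i j k ≡ k
  transpose-elsewhere {i} {j} {k} k≢i k≢j with k FP.≟ i
  ... | yes k≡i = ⊥-elim (k≢i k≡i)
  ... | no  _ with k FP.≟ j
  ...   | yes k≡j = ⊥-elim (k≢j k≡j)
  ...   | no  _   = refl

  swap : Perm n → Fin n → Fin n → Perm n
  swap x c d = x ∘ₚ transpose d c

  module _ {x : Perm n} {c d : Fin n} (desc : Descent x c d) where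
    open Descent desc

    private
      pos′ : Fin n → ℕ
      pos′ = pos (swap x c d)

      pos′-c : pos′ c ≡ pos x d
      pos′-c = cong (pos x) (transpose-at-i c d)

      pos′-d : pos′ d ≡ pos x c
      pos′-d = cong (pos x) (transpose-at-j c d)

      pos′-other : {v : Fin n} → v ≢ c → v ≢ d → pos′ v ≡ pos x v
      pos′-other v≢c v≢d = cong (pos x) (transpose-elsewhere v≢c v≢d)

      c<d : pos x c ℕ.< pos x d
      c<d = ℕP.≤-reflexive adjacent

      above-c⇒above-d : {v : Fin n} → v ≢ d → pos x c ℕ.< pos x v → pos x d ℕ.< pos x v
      above-c⇒above-d v≢d cv = ℕP.≤∧≢⇒< (subst (ℕ._≤ _) adjacent cv) (λ dv → v≢d (pos-injective x (sym dv)))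

      below-d⇒below-c : {v : Fin n} → v ≢ c → pos x v ℕ.< pos x d → pos x v ℕ.< pos x c
      below-d⇒below-c v≢c vd =
        ℕP.≤∧≢⇒< (ℕP.≤-pred (subst (_ ℕ.<_) (sym adjacent) vd)) (λ vc → v≢c (pos-injective x vc))

      data Site : Fin n → Set where
        at-c  : Site c
        at-d  : Site d
        other : {v : Fin n} → v ≢ c → v ≢ d → Site v

      site : ∀ v → Site v
      site v with v FP.≟ c | v FP.≟ d
      ... | yes refl | _        = at-c
      ... | no  _    | yes refl = at-d
      ... | no  v≢c  | no  v≢d  = other v≢c v≢d

      d≮c : ¬ (c < d)
      d≮c c<d′ = FP.<-asym c<d′ smaller

      moved : {i j k l : ℕ} → i ≡ k → j ≡ l → k ℕ.< l → i ℕ.< j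
      moved eᵢ eⱼ = subst₂ ℕ._<_ (sym eᵢ) (sym eⱼ)

      unmoved : {i j k l : ℕ} → i ≡ k → j ≡ l → i ℕ.< j → k ℕ.< l
      unmoved = subst₂ ℕ._<_

    swap-¬Inv : ¬ Inv (swap x c d) c d
    swap-¬Inv (_ , cd) = ℕP.<-asym c<d (unmoved pos′-c pos′-d cd)

    swap-≤w : swap x c d ≤w x
    swap-≤w a b (b<a , ab) with site a | site b
    ... | at-c          | at-c          = ⊥-elim (FP.<-irrefl refl b<a)
    ... | at-c          | at-d          = ⊥-elim (swap-¬Inv (b<a , ab))
    ... | at-c          | other b≢c b≢d = b<a , ℕP.<-trans c<d (unmoved pos′-c (pos′-other b≢c b≢d) ab)
    ... | at-d          | at-c          = ⊥-elim (d≮c b<a)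
    ... | at-d          | at-d          = ⊥-elim (FP.<-irrefl refl b<a)
    ... | at-d          | other b≢c b≢d = b<a , above-c⇒above-d b≢d (unmoved pos′-d (pos′-other b≢c b≢d) ab)
    ... | other a≢c a≢d | at-c          = b<a , below-d⇒below-c a≢c (unmoved (pos′-other a≢c a≢d) pos′-c ab)
    ... | other a≢c a≢d | at-d          = b<a , ℕP.<-trans (unmoved (pos′-other a≢c a≢d) pos′-d ab) c<d
    ... | other a≢c a≢d | other b≢c b≢d = b<a , unmoved (pos′-other a≢c a≢d) (pos′-other b≢c b≢d) ab

    Inv⇒Inv-swap : {a b : Fin n} → Inv x a b → ¬ (a ≡ c × b ≡ d) → Inv (swap x c d) a b
    Inv⇒Inv-swap {a} {b} (b<a , ab) ≢cd with site a | site b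
    ... | at-c          | at-c          = ⊥-elim (FP.<-irrefl refl b<a)
    ... | at-c          | at-d          = ⊥-elim (≢cd (refl , refl))
    ... | at-c          | other b≢c b≢d = b<a , moved pos′-c (pos′-other b≢c b≢d) (above-c⇒above-d b≢d ab)
    ... | at-d          | at-c          = ⊥-elim (d≮c b<a)
    ... | at-d          | at-d          = ⊥-elim (FP.<-irrefl refl b<a)
    ... | at-d          | other b≢c b≢d = b<a , moved pos′-d (pos′-other b≢c b≢d) (ℕP.<-trans c<d ab)
    ... | other a≢c a≢d | at-c          = b<a , moved (pos′-other a≢c a≢d) pos′-c (ℕP.<-trans ab c<d)
    ... | other a≢c a≢d | at-d          = b<a , moved (pos′-other a≢c a≢d) pos′-d (below-d⇒below-c a≢c ab)
    ... | other a≢c a≢d | other b≢c b≢d = b<a , moved (pos′-other a≢c a≢d) (pos′-other b≢c b≢d) ab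

    ≤w-swap : {t : Perm n} → t ≤w x → ¬ Inv t c d → t ≤w swap x c d
    ≤w-swap t≤x ¬tcd a b tab = Inv⇒Inv-swap (t≤x a b tab) λ { (refl , refl) → ¬tcd tab }

    swap-join : {t : Perm n} → t ≤w x → Inv t c d → IsJoin (swap x c d ∷ t ∷ []) x
    swap-join {t} t≤x tcd = (swap-≤w ∷ t≤x ∷ []) , least
      where
      least : ∀ u → All (_≤w u) (swap x c d ∷ t ∷ []) → x ≤w u
      least u (swap≤u ∷ t≤u ∷ []) a b xab with a FP.≟ c | b FP.≟ d
      ... | yes refl | yes refl = t≤u c d tcd
      ... | no  a≢c  | _        = swap≤u a b (Inv⇒Inv-swap xab λ (a≡c , _) → a≢c a≡c)
      ... | _        | no  b≢d  = swap≤u a b (Inv⇒Inv-swap xab λ (_ , b≡d) → b≢d b≡d)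

  #inv : Perm n → ℕ
  #inv x = ∑ λ a → ∑ λ b → [ Inv? x a b ]

  #inv-mono-< : {x y : Perm n} → y ≤w x → ∀ c d → Inv x c d → ¬ Inv y c d → #inv y ℕ.< #inv x
  #inv-mono-< {x} {y} y≤x c d xcd ¬ycd =
    ∑-mono-< (λ a → ∑-mono (indicator a)) c
      (∑-mono-< (indicator c) d ([]-mono-< ¬ycd xcd (Inv? y c d) (Inv? x c d)))
    where
    indicator : ∀ a b → [ Inv? y a b ] ℕ.≤ [ Inv? x a b ]
    indicator a b = []-mono (y≤x a b) (Inv? y a b) (Inv? x a b)

  #inv-swap : {x : Perm n} {c d : Fin n} → Descent x c d → #inv (swap x c d) ℕ.< #inv x
  #inv-swap {x} {c} {d} desc =
    #inv-mono-< {x} {swap x c d} (swap-≤w desc) c d (Descent⇒Inv desc) (swap-¬Inv desc)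

  module Descend (Allowed : Perm n → Fin n → Fin n → Set) (Allowed? : ∀ x c d → Dec (Allowed x c d))
                 (Invariant : Perm n → Set)
                 (preserved : ∀ {x c d} → Descent x c d → Allowed x c d →
                              Invariant x → Invariant (swap x c d)) where

    Stuck : Perm n → Set
    Stuck y = ∀ {c d} → Descent y c d → ¬ Allowed y c d

    private
      step? : (x : Perm n) → Dec (∃₂ λ c d → Descent x c d × Allowed x c d)
      step? x = FP.any? λ c → FP.any? λ d → Descent? x c d ×-dec Allowed? x c d

      descend-within : ∀ fuel (x : Perm n) → #inv x ℕ.< fuel → Invariant x →
                       Σ (Perm n) λ y → Invariant y × Stuck y
      descend-within (suc fuel) x bound inv with step? x
      ... | yes (c , d , desc , allowed) =
            descend-within fuel (swap x c d) (ℕP.<-≤-trans (#inv-swap desc) (ℕP.≤-pred bound))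
              (preserved desc allowed inv)
      ... | no stuck = x , inv , λ desc allowed → stuck (_ , _ , desc , allowed)

    descend : (x : Perm n) → Invariant x → Σ (Perm n) λ y → Invariant y × Stuck y
    descend x = descend-within (suc (#inv x)) x (ℕP.n<1+n _)

  -- Descents control inversions

  successor : (x : Perm n) (a : Fin n) → suc (pos x a) ℕ.< n → Σ (Fin n) (Adjacent x a)
  successor x a a+1<n = x ⟨$⟩ʳ fromℕ< a+1<n , sym (trans (cong toℕ (inverseˡ x)) (FP.toℕ-fromℕ< a+1<n))

  record Crossing (x : Perm n) (Q : Fin n → Set) (a b : Fin n) : Set where
    field
      e f      : Fin n
      adjacent : Adjacent x e f
      from     : pos x a ℕ.≤ pos x e
      to       : pos x f ℕ.≤ pos x b
      holds    : Q e
      fails    : ¬ Q f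

  module _ (x : Perm n) {Q : Fin n → Set} (Q? : ∀ v → Dec (Q v)) where

    private
      crossing-within : ∀ k {a b} → pos x a ℕ.+ k ≡ pos x b → Q a → ¬ Q b → Crossing x Q a b
      crossing-within zero eq qa ¬qb =
        ⊥-elim (¬qb (subst Q (pos-injective x (trans (sym (ℕP.+-identityʳ _)) eq)) qa))
      crossing-within (suc k) {a} {b} eq qa ¬qb = step (successor x a (ℕP.≤-<-trans a<b (FP.toℕ<n (x ⟨$⟩ˡ b))))
        where
        a<b : pos x a ℕ.< pos x b
        a<b = subst (pos x a ℕ.<_) eq (ℕP.m<m+n (pos x a) (s≤s z≤n))

        step : Σ (Fin n) (Adjacent x a) → Crossing x Q a b
        step (a′ , adj) with Q? a′
        ... | no ¬qa′ = record { e = a ; f = a′ ; adjacent = adj ; from = ℕP.≤-refl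
                               ; to = subst (ℕ._≤ pos x b) adj a<b ; holds = qa ; fails = ¬qa′ }
        ... | yes qa′ = record { e = e ; f = f ; adjacent = adjacent
                               ; from = ℕP.<⇒≤ (subst (ℕ._≤ pos x e) (sym adj) from)
                               ; to = to ; holds = holds ; fails = fails }
          where
          open Crossing (crossing-within k (trans (cong (ℕ._+ k) (sym adj)) (trans (sym (ℕP.+-suc _ k)) eq))
                                         qa′ ¬qb)

    crossing : {a b : Fin n} → pos x a ℕ.≤ pos x b → Q a → ¬ Q b → Crossing x Q a b
    crossing {a} {b} ab = crossing-within (pos x b ℕ.∸ pos x a) (ℕP.m+[n∸m]≡n ab)

  Inv-narrow : (x t : Perm n) {a b e f : Fin n} → t ≤w x → Inv t e f → b < a →
               a ≡ e ⊎ a < e → f ≡ b ⊎ f < b → pos x a ℕ.≤ pos x e → pos x f ℕ.≤ pos x b → Inv t a b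
  Inv-narrow x t {a} {b} {e} {f} t≤x tef b<a a≤e f≤b ae fb = narrowˡ a≤e (narrowʳ f≤b)
    where
    b<e : b < e
    b<e = [ (λ { refl → b<a }) , FP.<-trans b<a ]′ a≤e

    narrowʳ : f ≡ b ⊎ f < b → Inv t e b
    narrowʳ (inj₁ refl) = tef
    narrowʳ (inj₂ f<b) with Inv-split t tef f<b b<e
    ... | inj₁ teb = teb
    ... | inj₂ tbf = ⊥-elim (pos≤⇒¬Inv x fb (t≤x _ _ tbf))

    narrowˡ : a ≡ e ⊎ a < e → Inv t e b → Inv t a b
    narrowˡ (inj₁ refl) teb = teb
    narrowˡ (inj₂ a<e)  teb with Inv-split t teb b<a a<e
    ... | inj₁ tea = ⊥-elim (pos≤⇒¬Inv x ae (t≤x _ _ tea))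
    ... | inj₂ tab = tab

  module _ (u : Perm n) (V : Fin n → Fin n → Set) (V-trans : ∀ {a b c} → V a b → V b c → V a c)
           (covered : ∀ {c d} → Descent u c d →
                      ∃ λ t → t ≤w u × Inv t c d × (∀ {a b} → Inv t a b → V a b)) where

    -- Induction on the positional gap of (a, b): where the values first drop below a, either the value
    -- f reached splits (a, b) into two inversions, or the descent there is covered by a t inverting (a, b).
    private
      within : ∀ k {a b} → Inv u a b → pos u b ℕ.≤ pos u a ℕ.+ k → V a b
      within zero (_ , ab) gap =
        ⊥-elim (ℕP.<-irrefl refl (ℕP.<-≤-trans ab (subst (_ ℕ.≤_) (ℕP.+-identityʳ _) gap)))
      within (suc k) {a} {b} (b<a , ab) gap with crossing u (a F.≤?_) (ℕP.<⇒≤ ab) ℕP.≤-refl (ℕP.<⇒≱ b<a)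
      ... | record { e = e ; f = f ; adjacent = adj ; from = ae ; to = fb ; holds = a≤e ; fails = a≰f }
          with b F.<? f
      ...   | yes b<f = V-trans (within k (f<a , af) (ℕP.≤-pred (ℕP.<-≤-trans fb′ gap′)))
                                (within k (b<f , fb′) (ℕP.≤-trans gap′ (ℕP.+-monoˡ-≤ k af)))
        where
        f<a : f < a
        f<a = ℕP.≰⇒> a≰f
        af : pos u a ℕ.< pos u f
        af = ℕP.≤-<-trans ae (ℕP.≤-reflexive adj)
        fb′ : pos u f ℕ.< pos u b
        fb′ = ℕP.≤∧≢⇒< fb λ fb≡ → FP.<-irrefl (sym (pos-injective u fb≡)) b<f
        gap′ : pos u b ℕ.≤ suc (pos u a ℕ.+ k)
        gap′ = subst (pos u b ℕ.≤_) (ℕP.+-suc _ k) gap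
      ...   | no  b≮f with covered (descent (ℕP.<-≤-trans (ℕP.≰⇒> a≰f) a≤e) adj)
      ...     | t , t≤u , tef , t⊆V =
                t⊆V (Inv-narrow u t t≤u tef b<a (≯⇒≡⊎< (ℕP.≤⇒≯ a≤e)) (≯⇒≡⊎< b≮f) ae fb)

    Inv⊆-from-descents : ∀ {a b} → Inv u a b → V a b
    Inv⊆-from-descents {a} {b} i = within (pos u b) i (ℕP.m≤n+m (pos u b) (pos u a))

  ≤w-from-descents : {t y : Perm n} → t ≤w y → (∀ {c d} → Descent y c d → Inv t c d) → y ≤w t
  ≤w-from-descents {t} {y} t≤y forced a b =
    Inv⊆-from-descents y (Inv t) (Inv-trans t) (λ desc → t , t≤y , forced desc , λ i → i)

  descent-missed : {t y : Perm n} → t ≤w y → ¬ (y ≤w t) → ∃₂ λ c d → Descent y c d × ¬ Inv t c d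
  descent-missed {t} {y} t≤y y≰t
    with FP.any? (λ c → FP.any? λ d → Descent? y c d ×-dec ¬? (Inv? t c d))
  ... | yes (c , d , missed) = c , d , missed
  ... | no  none = ⊥-elim (y≰t (≤w-from-descents {t} {y} t≤y λ {c} {d} desc →
                     decidable-stable (Inv? t c d) λ ¬tcd → none (c , d , desc , ¬tcd)))

  -- Joins

  Forced : List (Perm n) → Perm n → Set
  Forced S x = ∀ {c d} → Descent x c d → Any (λ t → Inv t c d) S

  forced⇒IsJoin : {S : List (Perm n)} {x : Perm n} → All (_≤w x) S → Forced S x → IsJoin S x
  forced⇒IsJoin {S} {x} S≤x forced = S≤x , λ u S≤u a b →
    Inv⊆-from-descents x (Inv u) (Inv-trans u) (λ desc → witness {u} S≤u (forced desc))
    where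
    witness : ∀ {u c d} → All (_≤w u) S → Any (λ t → Inv t c d) S →
              ∃ λ t → t ≤w x × Inv t c d × (∀ {a b} → Inv t a b → Inv u a b)
    witness S≤u any with All.lookupAny (All.zip (S≤x , S≤u)) any
    ... | (t≤x , t≤u) , tcd = Any.lookup any , t≤x , tcd , t≤u _ _

  IsJoin⇒forced : {S : List (Perm n)} {x : Perm n} → IsJoin S x → Forced S x
  IsJoin⇒forced {S} {x} (S≤x , least) {c} {d} desc with Any.any? (λ t → Inv? t c d) S
  ... | yes forced = forced
  ... | no  unforced = ⊥-elim (swap-¬Inv desc (least (swap x c d) S≤swap c d (Descent⇒Inv desc)))
    where
    S≤swap : All (_≤w swap x c d) S
    S≤swap = All.zipWith (λ {t} (t≤x , ¬tcd) → ≤w-swap desc {t} t≤x ¬tcd) (S≤x , ¬Any⇒All¬ S unforced)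

  forcing-member : {T : List (Perm n)} {x : Perm n} → IsJoin T x →
                   ∀ {c d} → Descent x c d → ∃ λ t → t ∈≈ T × Inv t c d
  forcing-member {T} {x} join desc = Any⇒∈≈ (IsJoin⇒forced {S = T} {x} join desc)

  module _ (S : List (Perm n)) where

    private
      Unforced : Perm n → Fin n → Fin n → Set
      Unforced _ c d = ¬ Any (λ t → Inv t c d) S

      open Descend Unforced (λ _ c d → ¬? (Any.any? (λ t → Inv? t c d) S)) (λ x → All (_≤w x) S)
        (λ desc unforced S≤x →
           All.zipWith (λ {t} (t≤x , ¬tcd) → ≤w-swap desc {t} t≤x ¬tcd) (S≤x , ¬Any⇒All¬ S unforced))

      top : Σ (Perm n) λ y → All (_≤w y) S × Stuck y
      top = descend reverse (All.tabulate λ {t} _ → reverse-greatest t)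

    ⋁ : Perm n
    ⋁ = proj₁ top

    ⋁-forced : Forced S ⋁
    ⋁-forced {c} {d} desc = decidable-stable (Any.any? (λ t → Inv? t c d) S) (proj₂ (proj₂ top) desc)

    ⋁-isJoin : IsJoin S ⋁
    ⋁-isJoin = forced⇒IsJoin (proj₁ (proj₂ top)) ⋁-forced

  -- Permutations generated by a single descent

  record Generated (u : Perm n) (p q : Fin n) : Set where
    field
      inverts : Inv u p q
      left    : ∀ a b → Inv u a b → a ≡ p ⊎ (a < p × Inv u a q)
      right   : ∀ a b → Inv u a b → b ≡ q ⊎ (q < b × Inv u p b)

  single-descent⇒Generated : {u : Perm n} {p q : Fin n} → Inv u p q →
                             (∀ {c d} → Descent u c d → c ≡ p × d ≡ q) → Generated u p q
  single-descent⇒Generated {u} {p} {q} upq only = record { inverts = upq ; left = left ; right = right }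
    where
    left : ∀ a b → Inv u a b → a ≡ p ⊎ (a < p × Inv u a q)
    left a b (b<a , ab) with crossing u (a F.≤?_) (ℕP.<⇒≤ ab) ℕP.≤-refl (ℕP.<⇒≱ b<a)
    ... | record { e = e ; f = f ; adjacent = adj ; from = ae ; holds = a≤e ; fails = a≰f }
        with only (descent (ℕP.<-≤-trans (ℕP.≰⇒> a≰f) a≤e) adj)
    ...   | refl , refl with ≯⇒≡⊎< (ℕP.≤⇒≯ a≤e)
    ...     | inj₁ a≡p = inj₁ a≡p
    ...     | inj₂ a<p = inj₂ (a<p , ℕP.≰⇒> a≰f , ℕP.≤-<-trans ae (ℕP.≤-reflexive adj))

    right : ∀ a b → Inv u a b → b ≡ q ⊎ (q < b × Inv u p b)
    right a b (b<a , ab) with crossing u (b F.<?_) (ℕP.<⇒≤ ab) b<a (FP.<-irrefl refl)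
    ... | record { e = e ; f = f ; adjacent = adj ; to = fb ; holds = b<e ; fails = b≮f }
        with only (descent (ℕP.≤-<-trans (ℕP.≮⇒≥ b≮f) b<e) adj)
    ...   | refl , refl with ≯⇒≡⊎< b≮f
    ...     | inj₁ q≡b = inj₁ (sym q≡b)
    ...     | inj₂ q<b = inj₂ (q<b , b<e , ℕP.<-≤-trans (ℕP.≤-reflexive adj) fb)

  module _ {y : Perm n} {p q : Fin n} (desc : Descent y p q) where

    open Descend (λ _ c d → ¬ (c ≡ p × d ≡ q)) (λ _ c d → ¬? ((c FP.≟ p) ×-dec (d FP.≟ q)))
                 (λ u → u ≤w y × Inv u p q)
                 (λ {u} {c} {d} desc′ ≢pq (u≤y , upq) →
                    ≤w-trans {x = swap u c d} {u} {y} (swap-≤w desc′) u≤y ,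
                    Inv⇒Inv-swap desc′ upq λ (p≡c , q≡d) → ≢pq (sym p≡c , sym q≡d))

    generator : ∃ λ u → u ≤w y × Generated u p q
    generator with descend y (≤w-refl {x = y} , Descent⇒Inv desc)
    ... | u , (u≤y , upq) , stuck =
          u , u≤y , single-descent⇒Generated upq λ {c} {d} desc′ →
                      decidable-stable ((c FP.≟ p) ×-dec (d FP.≟ q)) (stuck desc′)

  ≤w-of-generated : {s x t : Perm n} {p q : Fin n} → Generated s p q → s ≤w x → Adjacent x p q →
                    t ≤w x → Inv t p q → s ≤w t
  ≤w-of-generated {s} {x} {t} {p} {q} gen s≤x adj t≤x tpq a b sab =
    extendʳ (Generated.right gen a b sab) (extendˡ (Generated.left gen a b sab))
    where
    extendˡ : a ≡ p ⊎ (a < p × Inv s a q) → Inv t a q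
    extendˡ (inj₁ refl) = tpq
    extendˡ (inj₂ (a<p , saq)) with Inv-split t tpq (proj₁ saq) a<p
    ... | inj₁ tpa = ⊥-elim (nothing-between x adj (proj₂ (t≤x p a tpa)) (proj₂ (s≤x a q saq)))
    ... | inj₂ taq = taq

    extendʳ : b ≡ q ⊎ (q < b × Inv s p b) → Inv t a q → Inv t a b
    extendʳ (inj₁ refl) taq = taq
    extendʳ (inj₂ (q<b , spb)) taq with Inv-split t taq q<b (proj₁ sab)
    ... | inj₁ tab = tab
    ... | inj₂ tbq = ⊥-elim (nothing-between x adj (proj₂ (s≤x p b spb)) (proj₂ (t≤x b q tbq)))

  Generated-unique : {s : Perm n} {p q p′ q′ : Fin n} → Generated s p q → Generated s p′ q′ → p ≡ p′ × q ≡ q′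
  Generated-unique {p = p} {q} {p′} {q′} g g′ =
    same (Generated.left g′ p q (Generated.inverts g)) (Generated.left g p′ q′ (Generated.inverts g′)) ,
    same (map₁ sym (Generated.right g p′ q′ (Generated.inverts g′)))
         (map₁ sym (Generated.right g′ p q (Generated.inverts g)))
    where
    same : ∀ {i j : Fin n} {A B : Set} → i ≡ j ⊎ (i < j × A) → j ≡ i ⊎ (j < i × B) → i ≡ j
    same (inj₁ i≡j)       _                 = i≡j
    same (inj₂ _)         (inj₁ j≡i)        = sym j≡i
    same (inj₂ (i<j , _)) (inj₂ (j<i , _))  = ⊥-elim (FP.<-asym i<j j<i)

  Generated-transfer : {s u : Perm n} {p q : Fin n} → u ≤w s → s ≤w u → Generated u p q → Generated s p q
  Generated-transfer {s} {u} {p} {q} u≤s s≤u g = record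
    { inverts = u≤s p q (Generated.inverts g)
    ; left    = λ a b sab → map₂ (λ (a<p , uaq) → a<p , u≤s a q uaq) (Generated.left g a b (s≤u a b sab))
    ; right   = λ a b sab → map₂ (λ (q<b , upb) → q<b , u≤s p b upb) (Generated.right g a b (s≤u a b sab))
    }

  -- Edges of the canonical join complex

  pair-irredundant⇒≰ : {s t y : Perm n} → ¬ (s ≈ t) → IsJoin (s ∷ t ∷ []) y →
                       Irredundant (s ∷ t ∷ []) y → ¬ (s ≤w t)
  pair-irredundant⇒≰ {s} {t} {y} s≉t (_ ∷ t≤y ∷ [] , least) irredundant s≤t =
    irredundant (t ∷ []) (there (here (λ _ → refl)) ∷ [])
      (s , here (λ _ → refl) , λ { (here s≈t) → s≉t s≈t ; (there ()) })
      (t≤y ∷ [] , λ u → λ { (t≤u ∷ []) → least u (≤w-trans {x = s} {t} {u} s≤t t≤u ∷ t≤u ∷ []) })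

  record Separated (s t : Perm n) : Set where
    field
      p q       : Fin n
      generated : Generated s p q
      t-misses  : ¬ Inv t p q
      y         : Perm n
      s≤y       : s ≤w y
      t≤y       : t ≤w y
      adjacent  : Adjacent y p q

  separated : {s t : Perm n} → ¬ (s ≈ t) → Edge s t → Separated s t
  separated {s} {t} s≉t (_ , y , join@(s≤y ∷ t≤y ∷ [] , _) , irredundant , below)
    with descent-missed {t = t} {y} t≤y (λ y≤t →
           pair-irredundant⇒≰ {s = s} {t} {y} s≉t join irredundant (≤w-trans {x = s} {y} {t} s≤y y≤t))
  ... | p , q , desc , ¬tpq = record
    { p = p ; q = q ; generated = Generated-transfer u≤s s≤u u-generated ; t-misses = ¬tpq
    ; y = y ; s≤y = s≤y ; t≤y = t≤y ; adjacent = Descent.adjacent desc }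
    where
    spq : Inv s p q
    spq with IsJoin⇒forced join desc
    ... | here spq          = spq
    ... | there (here tpq)  = ⊥-elim (¬tpq tpq)

    u : Perm n
    u = proj₁ (generator desc)

    u≤y : u ≤w y
    u≤y = proj₁ (proj₂ (generator desc))

    u-generated : Generated u p q
    u-generated = proj₂ (proj₂ (generator desc))

    s≤u : s ≤w u
    s≤u with All.head (below (swap y p q ∷ u ∷ []) (swap-join desc {u} u≤y (Generated.inverts u-generated)))
    ... | here s≤swap       = ⊥-elim (swap-¬Inv desc (s≤swap p q spq))
    ... | there (here s≤u)  = s≤u

    u≤s : u ≤w s
    u≤s = ≤w-of-generated {x = y} {t = s} u-generated u≤y (Descent.adjacent desc) s≤y spq

  module Grading (s : Perm n) (p q : Fin n) where

    data Class (v : Fin n) : Set where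
      above  : p < v → Class v
      inner⁺ : q < v → v < p → Inv s v q → Class v
      at-p   : v ≡ p → Class v
      at-q   : v ≡ q → Class v
      inner⁻ : q < v → v < p → ¬ Inv s v q → Class v
      below  : v < q → Class v

    classify : ∀ v → Class v
    classify v with FP.<-cmp v p
    ... | tri> _ _ p<v = above p<v
    ... | tri≈ _ v≡p _ = at-p v≡p
    ... | tri< v<p _ _ with FP.<-cmp v q
    ...   | tri< v<q _ _ = below v<q
    ...   | tri≈ _ v≡q _ = at-q v≡q
    ...   | tri> _ _ q<v with Inv? s v q
    ...     | yes svq = inner⁺ q<v v<p svq
    ...     | no ¬svq = inner⁻ q<v v<p ¬svq

    rank : ∀ {v} → Class v → ℕ
    rank (above _)      = 0
    rank (inner⁺ _ _ _) = 1
    rank (at-p _)       = 2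
    rank (at-q _)       = 3
    rank (inner⁻ _ _ _) = 4
    rank (below _)      = 5

    -- Inversions of any y ≥ s with p right before q never lower the rank, and the relation is
    -- transitive, so it also bounds the inversions of a join of such permutations. Quantifying over
    -- both classifications spares us from ever evaluating `classify`.
    Graded : Fin n → Fin n → Set
    Graded a b = b < a × (∀ (ca : Class a) (cb : Class b) → rank ca ℕ.≤ rank cb)

    Graded-trans : ∀ {a b c} → Graded a b → Graded b c → Graded a c
    Graded-trans {b = b} (b<a , a≼b) (c<b , b≼c) =
      FP.<-trans c<b b<a , λ ca cc → ℕP.≤-trans (a≼b ca (classify b)) (b≼c (classify b) cc)

    Inv⊆Graded : {y : Perm n} → Inv s p q → s ≤w y → Adjacent y p q → ∀ a b → Inv y a b → Graded a b
    Inv⊆Graded {y} spq s≤y adj a b (b<a , ab) = b<a , ranked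
      where
      q<p : q < p
      q<p = proj₁ spq

      p-before : ∀ {v} → q < v → v < p → ¬ Inv s v q → pos y p ℕ.< pos y v
      p-before {v} q<v v<p ¬svq with Inv-split s spq q<v v<p
      ... | inj₁ spv = proj₂ (s≤y p v spv)
      ... | inj₂ svq = ⊥-elim (¬svq svq)

      before-q : ∀ {v} → Inv s v q → pos y v ℕ.< pos y q
      before-q svq = proj₂ (s≤y _ q svq)

      ranked : (ca : Class a) (cb : Class b) → rank ca ℕ.≤ rank cb
      ranked (above _)         _                 = z≤n
      ranked (inner⁺ _ a<p _)  (above p<b)       = ⊥-elim (FP.<-asym (FP.<-trans b<a a<p) p<b)
      ranked (inner⁺ _ a<p _)  (inner⁺ _ _ _)    = ℕP.≤-refl
      ranked (inner⁺ _ a<p _)  (at-p refl)       = ⊥-elim (FP.<-asym b<a a<p)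
      ranked (inner⁺ _ _ _)    (at-q _)          = s≤s z≤n
      ranked (inner⁺ _ _ _)    (inner⁻ _ _ _)    = s≤s z≤n
      ranked (inner⁺ _ _ _)    (below _)         = s≤s z≤n
      ranked (at-p refl)       (above p<b)       = ⊥-elim (FP.<-asym b<a p<b)
      ranked (at-p refl)       (inner⁺ _ _ sbq)  = ⊥-elim (nothing-between y adj ab (before-q sbq))
      ranked (at-p refl)       (at-p refl)       = ⊥-elim (FP.<-irrefl refl b<a)
      ranked (at-p refl)       (at-q _)          = s≤s (s≤s z≤n)
      ranked (at-p refl)       (inner⁻ _ _ _)    = s≤s (s≤s z≤n)
      ranked (at-p refl)       (below _)         = s≤s (s≤s z≤n)
      ranked (at-q refl)       (above p<b)       = ⊥-elim (FP.<-asym (FP.<-trans b<a q<p) p<b)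
      ranked (at-q refl)       (inner⁺ q<b _ _)  = ⊥-elim (FP.<-asym b<a q<b)
      ranked (at-q refl)       (at-p refl)       = ⊥-elim (FP.<-asym b<a q<p)
      ranked (at-q refl)       (at-q refl)       = ⊥-elim (FP.<-irrefl refl b<a)
      ranked (at-q refl)       (inner⁻ q<b _ _)  = ⊥-elim (FP.<-asym b<a q<b)
      ranked (at-q refl)       (below _)         = s≤s (s≤s (s≤s z≤n))
      ranked (inner⁻ _ a<p _)  (above p<b)       = ⊥-elim (FP.<-asym (FP.<-trans b<a a<p) p<b)
      ranked (inner⁻ q<a a<p ¬saq) (inner⁺ _ _ sbq) =
        ⊥-elim (nothing-between y adj (ℕP.<-trans (p-before q<a a<p ¬saq) ab) (before-q sbq))
      ranked (inner⁻ _ a<p _)  (at-p refl)       = ⊥-elim (FP.<-asym b<a a<p)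
      ranked (inner⁻ q<a a<p ¬saq) (at-q refl)   = ⊥-elim (nothing-between y adj (p-before q<a a<p ¬saq) ab)
      ranked (inner⁻ _ _ _)    (inner⁻ _ _ _)    = ℕP.≤-refl
      ranked (inner⁻ _ _ _)    (below _)         = s≤s (s≤s (s≤s (s≤s z≤n)))
      ranked (below a<q)       (above p<b)       = ⊥-elim (FP.<-asym (FP.<-trans b<a (FP.<-trans a<q q<p)) p<b)
      ranked (below a<q)       (inner⁺ q<b _ _)  = ⊥-elim (FP.<-asym (FP.<-trans b<a a<q) q<b)
      ranked (below a<q)       (at-p refl)       = ⊥-elim (FP.<-asym (FP.<-trans b<a a<q) q<p)
      ranked (below a<q)       (at-q refl)       = ⊥-elim (FP.<-asym b<a a<q)
      ranked (below a<q)       (inner⁻ q<b _ _)  = ⊥-elim (FP.<-asym (FP.<-trans b<a a<q) q<b)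
      ranked (below _)         (below _)         = ℕP.≤-refl

    no-inner-between : {x : Perm n} → (∀ a b → Inv x a b → Graded a b) →
                       ∀ {m} → q < m → m < p → pos x p ℕ.< pos x m → pos x m ℕ.< pos x q → ⊥
    no-inner-between x⊆G {m} q<m m<p pm mq with Inv? s m q
    ... | yes smq = ℕP.≤⇒≯ (proj₂ (x⊆G p m (m<p , pm)) (at-p refl) (inner⁺ q<m m<p smq)) ℕP.≤-refl
    ... | no ¬smq = ℕP.≤⇒≯ (proj₂ (x⊆G m q (q<m , mq)) (inner⁻ q<m m<p ¬smq) (at-q refl)) ℕP.≤-refl

  descent-persists : {s x : Perm n} {p q : Fin n} → Generated s p q → s ≤w x →
    (∀ {c d} → Descent x c d → ∃ λ t → t ≤w x × Inv t c d × (Inv t p q → t ≈ s)) →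
    (∀ {m} → q < m → m < p → pos x p ℕ.< pos x m → pos x m ℕ.< pos x q → ⊥) →
    Descent x p q
  descent-persists {s} {x} {p} {q} gen s≤x forced no-inner = subst₂ (Descent x) e≡p f≡q desc
    where
    spq : Inv s p q
    spq = Generated.inverts gen

    open Crossing (crossing x (q F.<?_) (ℕP.<⇒≤ (proj₂ (s≤x p q spq))) (proj₁ spq) (FP.<-irrefl refl))
      renaming (from to pe; to to fq; holds to q<e; fails to q≮f)

    desc : Descent x e f
    desc = descent (ℕP.≤-<-trans (ℕP.≮⇒≥ q≮f) q<e) adjacent

    e≮p : ¬ (e < p)
    e≮p e<p = no-inner q<e e<p (ℕP.≤∧≢⇒< pe λ pe≡ → FP.<-irrefl (pos-injective x (sym pe≡)) e<p)
                               (ℕP.<-≤-trans (ℕP.≤-reflexive adjacent) fq)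

    sef : Inv s e f
    sef with forced desc
    ... | t , t≤x , tef , tpq⇒t≈s =
          ≈⇒≤w {x = t} {s} (tpq⇒t≈s (Inv-narrow x t t≤x tef (proj₁ spq) (≯⇒≡⊎< e≮p) (≯⇒≡⊎< q≮f) pe fq)) e f tef

    e≡p : e ≡ p
    e≡p = [ (λ e≡p → e≡p) , (λ (e<p , _) → ⊥-elim (e≮p e<p)) ]′ (Generated.left gen e f sef)

    f≡q : f ≡ q
    f≡q = [ (λ f≡q → f≡q) , (λ (q<f , _) → ⊥-elim (q≮f q<f)) ]′ (Generated.right gen e f sef)

  record Joinand (S : List (Perm n)) (x s : Perm n) : Set where
    field
      p q         : Fin n
      generated   : Generated s p q
      descent-pq  : Descent x p q
      others-miss : ∀ {t} → t ∈≈ S → ¬ (t ≈ s) → ¬ Inv t p q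

  joinands⇒canonical : {S : List (Perm n)} {x : Perm n} → IsJoin S x →
                       (∀ {s} → s ∈≈ S → Joinand S x s) → CanonicalJoinRep S x
  joinands⇒canonical {S} {x} join@(S≤x , _) joinand = join , irredundant , below
    where
    module J {s} (s∈S : s ∈≈ S) = Joinand (joinand {s} s∈S)

    irredundant : Irredundant S x
    irredundant T T⊆S (s , s∈S , s∉T) T-join with forcing-member {T = T} {x} T-join (J.descent-pq {s} s∈S)
    ... | t , t∈T , tpq = s∉T (∈≈-resp {u = s} {t} (≈-sym {x = t} {s} t≈s) t∈T)
      where
      t≈s : t ≈ s
      t≈s = decidable-stable (t ≈? s) λ t≉s → J.others-miss {s} s∈S {t} (∈≈-⊆ T⊆S {t} t∈T) t≉s tpq

    below : ∀ T → IsJoin T x → All (λ s → Any (s ≤w_) T) S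
    below T T-join@(T≤x , _) = All.tabulate λ {s} s∈S → lower {s} (Any.map (λ { refl _ → refl }) s∈S)
      where
      lower : ∀ {s} → s ∈≈ S → Any (s ≤w_) T
      lower {s} s∈S with forcing-member {T = T} {x} T-join (J.descent-pq {s} s∈S)
      ... | t , t∈T , tpq = Any.map (λ {u} t≈u → ≤w-trans {x = s} {t} {u} s≤t (≈⇒≤w {x = t} {u} t≈u)) t∈T
        where
        s≤t : s ≤w t
        s≤t = ≤w-of-generated {x = x} {t = t} (J.generated {s} s∈S) (∈≈-upper {x = x} S≤x {s} s∈S)
                (Descent.adjacent (J.descent-pq {s} s∈S)) (∈≈-upper {x = x} T≤x {t} t∈T) tpq

  PairwiseEdges : List (Perm n) → Set
  PairwiseEdges S = ∀ a b → a ∈≈ S → b ∈≈ S → ¬ (a ≈ b) → Edge a b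

  module _ (S : List (Perm n)) (edges : PairwiseEdges S) where

    joinand : ∀ {s t} → s ∈≈ S → t ∈≈ S → ¬ (s ≈ t) → Joinand S (⋁ S) s
    joinand {s} {t} s∈S t∈S s≉t = record
      { p = p ; q = q ; generated = generated ; descent-pq = descent-pq
      ; others-miss = λ {t′} t′∈S t′≉s → proj₁ (separated-from {t′} t′∈S t′≉s) }
      where
      open Separated (separated {s = s} {t} s≉t (edges s t s∈S t∈S s≉t))
      open Grading s p q

      separated-from : ∀ {t′} → t′ ∈≈ S → ¬ (t′ ≈ s) → ¬ Inv t′ p q × (∀ a b → Inv t′ a b → Graded a b)
      separated-from {t′} t′∈S t′≉s = subst₂ (λ p′ q′ → ¬ Inv t′ p′ q′) (sym p≡) (sym q≡) t-misses′ ,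
        λ a b i → Inv⊆Graded {y = y′} (Generated.inverts generated) s≤y′
                    (subst₂ (Adjacent y′) (sym p≡) (sym q≡) adjacent′) a b (t≤y′ a b i)
        where
        s≉t′ : ¬ (s ≈ t′)
        s≉t′ s≈t′ = t′≉s (≈-sym {x = s} {t′} s≈t′)
        open Separated (separated {s = s} {t′} s≉t′ (edges s t′ s∈S t′∈S s≉t′))
          renaming (p to p′; q to q′; generated to generated′; t-misses to t-misses′; y to y′
                   ; s≤y to s≤y′; t≤y to t≤y′; adjacent to adjacent′)
        p≡ : p ≡ p′
        p≡ = proj₁ (Generated-unique generated generated′)
        q≡ : q ≡ q′
        q≡ = proj₂ (Generated-unique generated generated′)

      member-graded : ∀ {t′} → t′ ∈≈ S → ∀ a b → Inv t′ a b → Graded a b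
      member-graded {t′} t′∈S a b i with t′ ≈? s
      ... | yes t′≈s = Inv⊆Graded {y = y} (Generated.inverts generated) s≤y adjacent a b
                         (s≤y a b (≈⇒≤w {x = t′} {s} t′≈s a b i))
      ... | no  t′≉s = proj₂ (separated-from {t′} t′∈S t′≉s) a b i

      member : ∀ {c d} → Descent (⋁ S) c d → ∃ λ t′ → t′ ∈≈ S × Inv t′ c d
      member = forcing-member {T = S} {⋁ S} (⋁-isJoin S)

      member-below : ∀ {t′} → t′ ∈≈ S → t′ ≤w ⋁ S
      member-below {t′} = ∈≈-upper {x = ⋁ S} (proj₁ (⋁-isJoin S)) {t′}

      join-graded : ∀ a b → Inv (⋁ S) a b → Graded a b
      join-graded a b = Inv⊆-from-descents (⋁ S) Graded Graded-trans
        (λ desc → let (t′ , t′∈S , t′cd) = member desc in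
                  t′ , member-below {t′} t′∈S , t′cd , λ {a} {b} → member-graded {t′} t′∈S a b)

      descent-pq : Descent (⋁ S) p q
      descent-pq = descent-persists {x = ⋁ S} generated (member-below {s} s∈S)
        (λ desc → let (t′ , t′∈S , t′cd) = member desc in
                  t′ , member-below {t′} t′∈S , t′cd , λ t′pq →
                    decidable-stable (t′ ≈? s) λ t′≉s → proj₁ (separated-from {t′} t′∈S t′≉s) t′pq)
        (no-inner-between {x = ⋁ S} join-graded)

    flag-canonical : (∀ s → s ∈≈ S → ∃ λ t → t ∈≈ S × ¬ (s ≈ t)) → CanonicalJoinRep S (⋁ S)
    flag-canonical partner = joinands⇒canonical (⋁-isJoin S) λ {s} s∈S →
      let (t , t∈S , s≉t) = partner s s∈S in joinand {s} {t} s∈S t∈S s≉t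

  IsJoin-resp-≈ : {T : List (Perm n)} {z j : Perm n} → IsJoin T z → z ≈ j → IsJoin T j
  IsJoin-resp-≈ {T} {z} {j} (T≤z , least) z≈j =
    All.map (λ {w} w≤z → ≤w-trans {x = w} {z} {j} w≤z (≈⇒≤w {x = z} {j} z≈j)) T≤z ,
    λ u T≤u → ≤w-trans {x = j} {z} {u} (≈⇒≤w {x = j} {z} (≈-sym {x = z} {j} z≈j)) (least u T≤u)

  JoinIrreducible⇒prime : {j : Perm n} → JoinIrreducible j → ∀ T → IsJoin T j → Any (j ≤w_) T
  JoinIrreducible⇒prime (not-bottom , _) [] join = ⊥-elim (not-bottom join)
  JoinIrreducible⇒prime {j} ji@(_ , binary) (t ∷ T) (t≤j ∷ T≤j , least) =
    [ (λ j≈t → here (≈⇒≤w {x = j} {t} j≈t))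
    , (λ j≈z → there (JoinIrreducible⇒prime {j} ji T
                        (IsJoin-resp-≈ {z = ⋁ T} {j} (⋁-isJoin T) (≈-sym {x = j} {⋁ T} j≈z))))
    ]′ (binary t (⋁ T) (t≤j ∷ z≤j ∷ [] , λ u → λ { (t≤u ∷ z≤u ∷ []) → least u (t≤u ∷ T≤u {u} z≤u) }))
    where
    z≤j : ⋁ T ≤w j
    z≤j = proj₂ (⋁-isJoin T) j T≤j

    T≤u : ∀ {u} → ⋁ T ≤w u → All (_≤w u) T
    T≤u {u} z≤u = All.map (λ {w} w≤z → ≤w-trans {x = w} {⋁ T} {u} w≤z z≤u) (proj₁ (⋁-isJoin T))

  constant-canonical : {s₀ : Perm n} {S : List (Perm n)} → JoinIrreducible s₀ → All (_≈ s₀) (s₀ ∷ S) →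
                       CanonicalJoinRep (s₀ ∷ S) s₀
  constant-canonical {s₀} {S} ji all≈ = join , irredundant , below
    where
    join : IsJoin (s₀ ∷ S) s₀
    join = All.map (λ {s} → ≈⇒≤w {x = s} {s₀}) all≈ , λ { u (s₀≤u ∷ _) → s₀≤u }

    irredundant : Irredundant (s₀ ∷ S) s₀
    irredundant []      _             _                 T-join = proj₁ ji T-join
    irredundant (t ∷ T) (t∈S ∷ _) (s , s∈S , s∉T) _ =
      s∉T (here (≈-trans {x = s} {s₀} {t} (∈≈-constant {s₀ = s₀} all≈ {s} s∈S)
                                          (≈-sym {x = t} {s₀} (∈≈-constant {s₀ = s₀} all≈ {t} t∈S))))

    below : ∀ T → IsJoin T s₀ → All (λ s → Any (s ≤w_) T) (s₀ ∷ S)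
    below T T-join = All.map (λ {s} s≈s₀ → Any.map (λ {t} → ≤w-trans {x = s} {s₀} {t} (≈⇒≤w {x = s} {s₀} s≈s₀))
                                                  (JoinIrreducible⇒prime {s₀} ji T T-join)) all≈

  empty-face : Face {n} []
  empty-face = [] , id , ([] , λ u _ → id-least u) , (λ { _ _ (_ , () , _) }) , λ _ _ → []

  partner : {s₀ : Perm n} {S : List (Perm n)} → Any (λ t → ¬ (t ≈ s₀)) S → s₀ ∈≈ S →
            ∀ s → s ∈≈ S → ∃ λ t → t ∈≈ S × ¬ (s ≈ t)
  partner {s₀} some≉s₀ s₀∈S s s∈S with s ≈? s₀ | Any⇒∈≈ some≉s₀
  ... | no  s≉s₀ | _             = s₀ , s₀∈S , s≉s₀
  ... | yes s≈s₀ | t , t∈S , t≉s₀ =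
        t , t∈S , λ s≈t → t≉s₀ (≈-trans {x = t} {s} {s₀} (≈-sym {x = s} {t} s≈t) s≈s₀)

corollary3p6 : (n : ℕ) → CanonicalJoinComplexIsFlag n
corollary3p6 n []       _           _     = empty-face
corollary3p6 n (s₀ ∷ S) irreducible edges with Any.any? (λ t → ¬? (t ≈? s₀)) (s₀ ∷ S)
... | yes some≉s₀ =
      irreducible , ⋁ (s₀ ∷ S) , flag-canonical (s₀ ∷ S) edges (partner {s₀ = s₀} some≉s₀ (here (λ _ → refl)))
... | no  none≉s₀ = irreducible , s₀ , constant-canonical (All.head irreducible)
                      (All.map (λ {t} → decidable-stable (t ≈? s₀)) (¬Any⇒All¬ (s₀ ∷ S) none≉s₀))
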